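{- Let $n\ge 1$ and let $T$ be a tree with $n+1$ vertices. Then there exist a graph $G(T)$ with $V(G(T))=V(T)$, $E(T)\subseteq E(G(T))$ and $|E(G(T))|=1+\binom{n}{2}$, and a cute $n$-edge-colouring of $G(T)$ for which $T$ is the unique heterochromatic spanning tree of $G(T)$.
   Context: An $n$-edge-colouring of a graph is a partition of its edge set into $n$ colour classes. For a graph with $n+1$ vertices and $1+\binom{n}{2}$ edges, an $n$-edge-colouring is called cute if the sizes of the $n$ colour classes are $1,1,2,3,\ldots,n-1$. A subgraph is heterochromatic if all its edges have different colours. -}

module Defs where

open import Data.Nat using (ℕ; zero; suc; _+_; _∸_; _≤_)
open import Data.Fin using (Fin; toℕ; _<_; _≟_)
open import Data.List using (List; []; _∷_; length; filter; map; upTo; allFin)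
open import Data.List.Relation.Unary.All using (All)
open import Data.List.Relation.Unary.Unique.Propositional using (Unique)
open import Data.List.Membership.Propositional using (_∈_)
open import Data.List.Relation.Binary.Permutation.Propositional using (_↭_)
open import Data.Product using (_×_; _,_; Σ; proj₁; proj₂)
open import Data.Sum using (_⊎_)
open import Relation.Binary.PropositionalEquality using (_≡_)
open import Relation.Nullary using (¬_)

-- An edge on vertex set Fin m is stored as an ordered pair (i , j) with i < j.
Edge : ℕ → Set
Edge m = Fin m × Fin m

EdgeList : ℕ → Set
EdgeList m = List (Edge m)

WF : ∀ {m} → EdgeList m → Set
WF E = All (λ e → proj₁ e < proj₂ e) E × Unique E

Adj : ∀ {m} → EdgeList m → Fin m → Fin m → Set
Adj E u v = ((u , v) ∈ E) ⊎ ((v , u) ∈ E)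

data Walk {m} (E : EdgeList m) : Fin m → Fin m → Set where
  here : ∀ {u} → Walk E u u
  step : ∀ {u v w} → Adj E u v → Walk E v w → Walk E u w

Connected : ∀ {m} → EdgeList m → Set
Connected {m} E = (u v : Fin m) → Walk E u v

Chain : ∀ {m} → EdgeList m → List (Fin m) → Set
Chain E [] = Data.Unit.⊤ where import Data.Unit
Chain E (x ∷ []) = Data.Unit.⊤ where import Data.Unit
Chain E (x ∷ y ∷ xs) = Adj E x y × Chain E (y ∷ xs)

IsCycle : ∀ {m} → EdgeList m → Fin m → List (Fin m) → Set
IsCycle E v₀ vs = (2 ≤ length vs) × Unique (v₀ ∷ vs) × Chain E (v₀ ∷ vs) × LastAdj vs
  where
  LastAdj : List _ → Set
  LastAdj [] = Data.Empty.⊥ where import Data.Empty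
  LastAdj (x ∷ []) = Adj E x v₀
  LastAdj (x ∷ y ∷ xs) = LastAdj (y ∷ xs)

Acyclic : ∀ {m} → EdgeList m → Set
Acyclic {m} E = (v₀ : Fin m) (vs : List (Fin m)) → ¬ IsCycle E v₀ vs

IsTree : ∀ {m} → EdgeList m → Set
IsTree E = WF E × Connected E × Acyclic E

_⊆E_ : ∀ {m} → EdgeList m → EdgeList m → Set
S ⊆E G = ∀ e → e ∈ S → e ∈ G

-- An n-edge-colouring: a colour in Fin n for each edge (only values on edges of G matter).
Colouring : ℕ → ℕ → Set
Colouring m n = Edge m → Fin n

classSize : ∀ {m n} → EdgeList m → Colouring m n → Fin n → ℕ
classSize G c k = length (filter (λ e → c e ≟ k) G)

-- the sizes 1,1,2,…,n-1 (a list of length n; for n = 1 it is just [1])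
cuteSizes : ℕ → List ℕ
cuteSizes n = 1 ∷ map suc (upTo (n ∸ 1))

Cute : ∀ {m n} → EdgeList m → Colouring m n → Set
Cute {n = n} G c = map (classSize G c) (allFin n) ↭ cuteSizes n

Heterochromatic : ∀ {m n} → Colouring m n → EdgeList m → Set
Heterochromatic c S = ∀ e f → e ∈ S → f ∈ S → c e ≡ c f → e ≡ f

HetSpanningTree : ∀ {m n} → EdgeList m → Colouring m n → EdgeList m → Set
HetSpanningTree G c S = S ⊆E G × IsTree S × Heterochromatic c S

SameEdges : ∀ {m} → EdgeList m → EdgeList m → Set
SameEdges S T = S ⊆E T × T ⊆E S

-- Number the vertices 0, …, n along an exploration of T, so that every vertex i ≥ 1 has a
-- T-neighbour p(i) < i.  Colour class k < n consists of the tree edge {p(k+1), k+1} and the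
-- non-tree pairs {a, k} with a < k, a ≠ p(k); it has one element for k = 0 and k elements
-- otherwise, which gives the cute sizes 1, 1, 2, …, n−1 and 1 + C(n,2) edges.
-- Let S be a heterochromatic spanning tree containing the tree edges of all colours above k.
-- A walk in S from k+1 to the root leaves the descendants of k+1 along some edge of S.  A
-- non-tree pair {a, j} can only leave them if j > k, but colour j is already taken by a tree
-- edge of S, and tree edges of colours other than k never leave them.  So S contains the tree
-- edge of colour k; by downward induction S ⊇ T, and heterochromaticity forces S = T.

module Submission where

open import Defs
open import Data.Nat using (ℕ; suc; _+_; _≤_)
open import Data.Nat.Combinatorics using (_C_)
open import Data.List using (length)
open import Data.Product using (Σ; _×_)
open import Relation.Binary.PropositionalEquality using (_≡_)

open import Data.Bool using (true; false)
open import Data.Empty using (⊥-elim)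
open import Data.Fin as Fin using (Fin; toℕ; fromℕ<)
open import Data.Fin.Properties as Finₚ using (toℕ-injective; toℕ-fromℕ<; toℕ<n; toℕ≤pred[n]; injective⇒≤)
open import Data.List using (List; []; _∷_; _++_; map; filter; downFrom; tabulate; applyUpTo; allFin)
open import Data.List.Properties using (filter-accept; filter-reject; filter-all; filter-none; filter-++; length-++; length-map; length-downFrom; map-tabulate; map-upTo; tabulate-cong; ++-identityʳ)
open import Data.List.Membership.Propositional using (_∈_)
open import Data.List.Membership.Propositional.Properties using (∈-map⁺; ∈-map⁻; ∈-filter⁻; ∈-++⁺ˡ; ∈-++⁺ʳ; ∈-++⁻; ∈-downFrom⁺; ∈-downFrom⁻)
open import Data.List.Relation.Unary.Any using (here; there)
open import Data.List.Relation.Unary.All as All using (All; []; _∷_)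
open import Data.List.Relation.Unary.All.Properties.Core using (¬Any⇒All¬)
import Data.List.Relation.Unary.All.Properties as Allₚ
open import Data.List.Relation.Unary.AllPairs using ([]; _∷_)
open import Data.List.Relation.Unary.Unique.Propositional using (Unique)
import Data.List.Relation.Unary.Unique.Propositional.Properties as Uniqueₚ
open import Data.List.Relation.Binary.Permutation.Propositional using (↭-reflexive)
open import Data.Nat using (zero; _<_; _∸_; _⊓_; _⊔_; z≤n; s≤s; s≤s⁻¹; NonZero; _≟_; _≤?_)
open import Data.Nat.Combinatorics using (nC1≡n; nCk+nC[k+1]≡[n+1]C[k+1])
open import Data.Nat.DivMod using (_mod_; m<n⇒m%n≡m)
open import Data.Nat.Induction using (<-rec)
open import Data.Nat.Properties
open import Data.Product using (_,_; proj₁; proj₂; ∃; ∃₂; uncurry)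
open import Data.Product.Properties using (≡-dec)
open import Data.Sum using (_⊎_; inj₁; inj₂)
open import Data.Unit using (tt)
open import Function using (_∘_; Injective)
open import Relation.Binary.Definitions using (tri<; tri≈; tri>)
open import Relation.Binary.PropositionalEquality using (refl; sym; trans; cong; cong₂; subst; subst₂; _≢_; module ≡-Reasoning)
open import Relation.Nullary using (¬_; Dec; yes; no; does; ¬?; contradiction)
open import Relation.Nullary.Decidable using (decidable-stable)
open import Relation.Unary using (Decidable)

lastOf : ∀ {A : Set} → A → List A → A
lastOf x [] = x
lastOf x (y ∷ ys) = lastOf y ys

Unique-map⁺-∈ : ∀ {A B : Set} {f : A → B} {xs : List A} →
                (∀ {x y} → x ∈ xs → y ∈ xs → f x ≡ f y → x ≡ y) → Unique xs → Unique (map f xs)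
Unique-map⁺-∈ {xs = []} _ [] = []
Unique-map⁺-∈ {xs = x ∷ xs} inj (x∉xs ∷ u) =
  Allₚ.map⁺ (All.tabulate λ y∈ fx≡fy → All.lookup x∉xs y∈ (inj (here refl) (there y∈) fx≡fy))
  ∷ Unique-map⁺-∈ (λ x∈ y∈ → inj (there x∈) (there y∈)) u

toℕ-mod : ∀ {k n} .{{_ : NonZero n}} → k < n → toℕ (k mod n) ≡ k
toℕ-mod {k} {n} k<n = trans (toℕ-fromℕ< _) (m<n⇒m%n≡m k<n)

mod-injective : ∀ {a b n} .{{_ : NonZero n}} → a < n → b < n → a mod n ≡ b mod n → a ≡ b
mod-injective a<n b<n eq = trans (sym (toℕ-mod a<n)) (trans (cong toℕ eq) (toℕ-mod b<n))

_≢?_ : (a q : ℕ) → Dec (a ≢ q)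
a ≢? q = ¬? (a ≟ q)

length-filter-≢-downFrom : ∀ {q k} → q < k → suc (length (filter (_≢? q) (downFrom k))) ≡ k
length-filter-≢-downFrom {q} {suc k} q<1+k with m<1+n⇒m<n∨m≡n q<1+k
... | inj₁ q<k =
  cong suc (trans (cong length (filter-accept (_≢? q) (<⇒≢ q<k ∘ sym))) (length-filter-≢-downFrom q<k))
... | inj₂ refl = cong suc (begin
    length (filter (_≢? q) (q ∷ downFrom q)) ≡⟨ cong length (filter-reject (_≢? q) (λ q≢q → q≢q refl)) ⟩
    length (filter (_≢? q) (downFrom q))     ≡⟨ cong length (filter-all (_≢? q) (All.tabulate below-≢)) ⟩
    length (downFrom q)                      ≡⟨ length-downFrom q ⟩
    q                                        ∎)
  where
  open ≡-Reasoning
  below-≢ : ∀ {a} → a ∈ downFrom q → a ≢ q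
  below-≢ a∈ a≡q = <-irrefl a≡q (∈-downFrom⁻ a∈)

filter-map : ∀ {A B : Set} {P : B → Set} (P? : Decidable P) (f : A → B) xs →
             filter P? (map f xs) ≡ map f (filter (P? ∘ f) xs)
filter-map P? f [] = refl
filter-map P? f (x ∷ xs) with does (P? (f x))
... | true = cong (f x ∷_) (filter-map P? f xs)
... | false = filter-map P? f xs

tabulate-toℕ : ∀ {A : Set} k (g : ℕ → A) → tabulate (g ∘ toℕ {k}) ≡ applyUpTo g k
tabulate-toℕ zero g = refl
tabulate-toℕ (suc k) g = cong (g 0 ∷_) (tabulate-toℕ k (g ∘ suc))

extendAfter : ∀ {A : Set} → (ℕ → A) → ℕ → A → ℕ → A
extendAfter f k a i with i ≤? k
... | yes _ = f i
... | no _ = a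

extendAfter-≤ : ∀ {A : Set} (f : ℕ → A) {k a i} → i ≤ k → extendAfter f k a i ≡ f i
extendAfter-≤ f {k} {a} {i} i≤k with i ≤? k
... | yes _ = refl
... | no i≰k = contradiction i≤k i≰k

extendAfter-> : ∀ {A : Set} (f : ℕ → A) {k a i} → k < i → extendAfter f k a i ≡ a
extendAfter-> f {k} {a} {i} k<i with i ≤? k
... | yes i≤k = contradiction i≤k (<⇒≱ k<i)
... | no _ = refl

-- Walks, paths and cycles

module _ {m : ℕ} where

  open import Data.List.Membership.DecPropositional (Fin._≟_ {m}) using (_∈?_)
  open import Data.List.Membership.DecPropositional (≡-dec (Fin._≟_ {m}) (Fin._≟_ {m})) using () renaming (_∈?_ to _∈E?_)

  Adj-sym : ∀ {E : EdgeList m} {x y} → Adj E x y → Adj E y x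
  Adj-sym (inj₁ xy∈E) = inj₂ xy∈E
  Adj-sym (inj₂ yx∈E) = inj₁ yx∈E

  Adj-mono : ∀ {E E′ : EdgeList m} {x y} → E ⊆E E′ → Adj E x y → Adj E′ x y
  Adj-mono E⊆E′ (inj₁ xy∈E) = inj₁ (E⊆E′ _ xy∈E)
  Adj-mono E⊆E′ (inj₂ yx∈E) = inj₂ (E⊆E′ _ yx∈E)

  Chain-mono : ∀ {E E′ : EdgeList m} → E ⊆E E′ → ∀ {xs} → Chain E xs → Chain E′ xs
  Chain-mono E⊆E′ {[]} _ = tt
  Chain-mono E⊆E′ {_ ∷ []} _ = tt
  Chain-mono E⊆E′ {_ ∷ _ ∷ _} (x~y , c) = Adj-mono E⊆E′ x~y , Chain-mono E⊆E′ c

  walk-++ : ∀ {E : EdgeList m} {x y z} → Walk E x y → Walk E y z → Walk E x z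
  walk-++ here w = w
  walk-++ (step x~y w) w′ = step x~y (walk-++ w w′)

  walk-reverse : ∀ {E : EdgeList m} {x y} → Walk E x y → Walk E y x
  walk-reverse here = here
  walk-reverse (step x~y w) = walk-++ (walk-reverse w) (step (Adj-sym x~y) here)

  walk-crossing : ∀ {E : EdgeList m} {P : Fin m → Set} → Decidable P → ∀ {x y} → Walk E x y → P x → ¬ P y →
                  ∃₂ λ u w → P u × ¬ P w × Adj E u w
  walk-crossing P? here Px ¬Py = contradiction Px ¬Py
  walk-crossing P? (step {v = z} x~z w) Px ¬Py with P? z
  ... | yes Pz = walk-crossing P? w Pz ¬Py
  ... | no ¬Pz = _ , z , Px , ¬Pz , x~z

  PathThrough : EdgeList m → Fin m → List (Fin m) → Fin m → Set
  PathThrough E x vs y = Unique (x ∷ vs) × Chain E (x ∷ vs) × lastOf x vs ≡ y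

  Path : EdgeList m → Fin m → Fin m → Set
  Path E x y = ∃ λ vs → PathThrough E x vs y

  path-suffix : ∀ {E : EdgeList m} {x z ws y} → x ∈ z ∷ ws → PathThrough E z ws y → Path E x y
  path-suffix (here refl) p = _ , p
  path-suffix {ws = _ ∷ _} (there x∈ws) (_ ∷ u , (_ , c) , l) = path-suffix x∈ws (u , c , l)

  walk⇒path : ∀ {E : EdgeList m} {x y} → Walk E x y → Path E x y
  walk⇒path here = [] , [] ∷ [] , tt , refl
  walk⇒path {x = x} (step {v = z} x~z w) with walk⇒path w
  ... | ws , u , c , l with x ∈? z ∷ ws
  ...   | yes x∈ = path-suffix x∈ (u , c , l)
  ...   | no x∉ = z ∷ ws , ¬Any⇒All¬ _ x∉ ∷ u , (x~z , c) , l

  -- `IsCycle` closes its cycle with a `where`-bound predicate that cannot be named outside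
  -- `Defs`; `Closes` recovers it as the last component of `IsCycle`.
  Closes : EdgeList m → Fin m → List (Fin m) → Set
  Closes E v₀ vs = proj₁ closing
    where
    closing : Σ Set λ D → IsCycle E v₀ vs ≡ (2 ≤ length vs × Unique (v₀ ∷ vs) × Chain E (v₀ ∷ vs) × D)
    closing = _ , refl

  closes : ∀ {E : EdgeList m} {v₀} x vs → Adj E (lastOf x vs) v₀ → Closes E v₀ (x ∷ vs)
  closes x [] last~v₀ = last~v₀
  closes x (y ∷ vs) last~v₀ = closes y vs last~v₀

  WF-< : ∀ {E : EdgeList m} → WF E → ∀ {x y} → (x , y) ∈ E → x Fin.< y
  WF-< (canonical , _) = All.lookup canonical

  acyclic⇒connected-subgraph-⊇ : ∀ {E E′ : EdgeList m} → WF E → Acyclic E → E′ ⊆E E → Connected E′ → E ⊆E E′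
  acyclic⇒connected-subgraph-⊇ {E} {E′} wf acyclic E′⊆E connected (x , y) xy∈E with (x , y) ∈E? E′
  ... | yes xy∈E′ = xy∈E′
  ... | no xy∉E′ with walk⇒path (connected x y)
  ...   | [] , _ , _ , x≡y = contradiction (cong toℕ x≡y) (<⇒≢ (WF-< wf xy∈E))
  ...   | _ ∷ [] , _ , (inj₁ xy∈E′ , _) , refl = contradiction xy∈E′ xy∉E′
  ...   | _ ∷ [] , _ , (inj₂ yx∈E′ , _) , refl = ⊥-elim (<-asym (WF-< wf xy∈E) (WF-< wf (E′⊆E _ yx∈E′)))
  ...   | vs@(_ ∷ _ ∷ _) , u , c , last≡y =
    ⊥-elim (acyclic x vs (s≤s (s≤s z≤n) , u , Chain-mono E′⊆E c ,
                          closes x vs (subst (λ z → Adj E z x) (sym last≡y) (inj₂ xy∈E))))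

  edge : Fin m → Fin m → Edge m
  edge x y with x Fin.<? y
  ... | yes _ = x , y
  ... | no _ = y , x

  Joins : Edge m → Fin m → Fin m → Set
  Joins f x y = f ≡ (x , y) ⊎ f ≡ (y , x)

  edge-joins : ∀ x y → Joins (edge x y) x y
  edge-joins x y with x Fin.<? y
  ... | yes _ = inj₁ refl
  ... | no _ = inj₂ refl

  Joins-edge : ∀ {u w x y} → Joins (edge u w) x y → (x ≡ u × y ≡ w) ⊎ (x ≡ w × y ≡ u)
  Joins-edge {u} {w} j with u Fin.<? w | j
  ... | yes _ | inj₁ refl = inj₁ (refl , refl)
  ... | yes _ | inj₂ refl = inj₂ (refl , refl)
  ... | no _ | inj₁ refl = inj₂ (refl , refl)
  ... | no _ | inj₂ refl = inj₁ (refl , refl)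

  edge-injective : ∀ {x y x′ y′} → edge x y ≡ edge x′ y′ → (x ≡ x′ × y ≡ y′) ⊎ (x ≡ y′ × y ≡ x′)
  edge-injective {x} {y} eq = Joins-edge (subst (λ f → Joins f x y) eq (edge-joins x y))

  edge-< : ∀ {x y} → x ≢ y → proj₁ (edge x y) Fin.< proj₂ (edge x y)
  edge-< {x} {y} x≢y with x Fin.<? y
  ... | yes x<y = x<y
  ... | no x≮y = ≤∧≢⇒< (≮⇒≥ x≮y) (x≢y ∘ toℕ-injective ∘ sym)

  Adj⇒joining : ∀ {E : EdgeList m} {x y} → Adj E x y → ∃ λ f → f ∈ E × Joins f x y
  Adj⇒joining (inj₁ xy∈E) = _ , xy∈E , inj₁ refl
  Adj⇒joining (inj₂ yx∈E) = _ , yx∈E , inj₂ refl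

  joining⇒Adj : ∀ {E : EdgeList m} {f x y} → f ∈ E → Joins f x y → Adj E x y
  joining⇒Adj f∈E (inj₁ refl) = inj₁ f∈E
  joining⇒Adj f∈E (inj₂ refl) = inj₂ f∈E

  edge-∈ : ∀ {E : EdgeList m} → WF E → ∀ {x y} → Adj E x y → edge x y ∈ E
  edge-∈ wf {x} {y} x~y with x Fin.<? y | x~y
  ... | yes _ | inj₁ xy∈E = xy∈E
  ... | yes x<y | inj₂ yx∈E = ⊥-elim (<-asym x<y (WF-< wf yx∈E))
  ... | no x≮y | inj₁ xy∈E = contradiction (WF-< wf xy∈E) x≮y
  ... | no _ | inj₂ yx∈E = yx∈E

-- Explorations of a connected graph

record Exploration {n : ℕ} (E : EdgeList (suc n)) (k : ℕ) : Set where
  field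
    vertex : ℕ → Fin (suc n)
    parent : ℕ → ℕ
    parent≤ : ∀ {i} → i < k → parent (suc i) ≤ i
    parent-adj : ∀ {i} → i < k → Adj E (vertex (suc i)) (vertex (parent (suc i)))
    vertex-injective : ∀ {i j} → i ≤ k → j ≤ k → vertex i ≡ vertex j → i ≡ j

  Explored : Fin (suc n) → Set
  Explored w = ∃ λ i → i < suc k × vertex i ≡ w

  explored? : Decidable Explored
  explored? w = anyUpTo? (λ i → vertex i Fin.≟ w) (suc k)

module _ {n : ℕ} {E : EdgeList (suc n)} where

  open Exploration

  root : Exploration E 0
  root = record
    { vertex = λ _ → Fin.zero
    ; parent = λ _ → 0
    ; parent≤ = λ ()
    ; parent-adj = λ ()
    ; vertex-injective = λ i≤0 j≤0 _ → trans (n≤0⇒n≡0 i≤0) (sym (n≤0⇒n≡0 j≤0))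
    }

  extend : ∀ {k} (X : Exploration E k) {u w} → Explored X u → ¬ Explored X w → Adj E u w → Exploration E (suc k)
  extend {k} X {u} {w} (j , j≤k , vertex-j≡u) w∉X u~w = record
    { vertex = vertex′
    ; parent = parent′
    ; parent≤ = parent′≤
    ; parent-adj = parent′-adj
    ; vertex-injective = vertex′-injective
    }
    where
    vertex′ = extendAfter (vertex X) k w
    parent′ = extendAfter (parent X) k j

    vertex′-old : ∀ {i} → i ≤ k → vertex′ i ≡ vertex X i
    vertex′-old = extendAfter-≤ (vertex X) {k}

    vertex′-new : vertex′ (suc k) ≡ w
    vertex′-new = extendAfter-> (vertex X) {k} ≤-refl

    parent′-old : ∀ {i} → i ≤ k → parent′ i ≡ parent X i
    parent′-old = extendAfter-≤ (parent X) {k}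

    parent′-new : parent′ (suc k) ≡ j
    parent′-new = extendAfter-> (parent X) {k} ≤-refl

    parent′≤ : ∀ {i} → i < suc k → parent′ (suc i) ≤ i
    parent′≤ i<1+k with m<1+n⇒m<n∨m≡n i<1+k
    ... | inj₁ i<k = subst (_≤ _) (sym (parent′-old i<k)) (parent≤ X i<k)
    ... | inj₂ refl = subst (_≤ k) (sym parent′-new) (m<1+n⇒m≤n j≤k)

    parent′-adj : ∀ {i} → i < suc k → Adj E (vertex′ (suc i)) (vertex′ (parent′ (suc i)))
    parent′-adj {i} i<1+k with m<1+n⇒m<n∨m≡n i<1+k
    ... | inj₁ i<k =
      subst₂ (Adj E) (sym (vertex′-old i<k))
        (sym (trans (cong vertex′ (parent′-old i<k)) (vertex′-old (≤-trans (parent≤ X i<k) (<⇒≤ i<k)))))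
        (parent-adj X i<k)
    ... | inj₂ refl =
      subst₂ (Adj E) (sym vertex′-new)
        (sym (trans (cong vertex′ parent′-new) (trans (vertex′-old (m<1+n⇒m≤n j≤k)) vertex-j≡u)))
        (Adj-sym u~w)

    vertex′-old≢new : ∀ {i} → i < suc k → vertex′ i ≢ vertex′ (suc k)
    vertex′-old≢new {i} i<1+k eq = w∉X (i , i<1+k , trans (sym (vertex′-old (m<1+n⇒m≤n i<1+k))) (trans eq vertex′-new))

    vertex′-injective : ∀ {i i′} → i ≤ suc k → i′ ≤ suc k → vertex′ i ≡ vertex′ i′ → i ≡ i′
    vertex′-injective {i} {i′} i≤ i′≤ eq with m≤n⇒m<n∨m≡n i≤ | m≤n⇒m<n∨m≡n i′≤
    ... | inj₁ (s≤s i≤k) | inj₁ (s≤s i′≤k) =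
      vertex-injective X i≤k i′≤k (trans (sym (vertex′-old i≤k)) (trans eq (vertex′-old i′≤k)))
    ... | inj₁ i<1+k | inj₂ refl = contradiction eq (vertex′-old≢new i<1+k)
    ... | inj₂ refl | inj₁ i′<1+k = contradiction (sym eq) (vertex′-old≢new i′<1+k)
    ... | inj₂ refl | inj₂ refl = refl

  exploration-bound : ∀ {k} → Exploration E k → k ≤ n
  exploration-bound {k} X = s≤s⁻¹ (injective⇒≤ {f = vertex X ∘ toℕ} injective)
    where
    injective : Injective _≡_ _≡_ (vertex X ∘ toℕ {suc k})
    injective {i} {j} eq = toℕ-injective (vertex-injective X (toℕ≤pred[n] i) (toℕ≤pred[n] j) eq)

  complete-bound : ∀ {k} (X : Exploration E k) → (∀ w → Explored X w) → n ≤ k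
  complete-bound {k} X complete = s≤s⁻¹ (injective⇒≤ {f = index} injective)
    where
    index : Fin (suc n) → Fin (suc k)
    index w = fromℕ< (proj₁ (proj₂ (complete w)))
    injective : Injective _≡_ _≡_ index
    injective {w} {w′} eq = begin
      w                                ≡⟨ sym (proj₂ (proj₂ (complete w))) ⟩
      vertex X (proj₁ (complete w))    ≡⟨ cong (vertex X) (trans (sym (toℕ-fromℕ< _)) (trans (cong toℕ eq) (toℕ-fromℕ< _))) ⟩
      vertex X (proj₁ (complete w′))   ≡⟨ proj₂ (proj₂ (complete w′)) ⟩
      w′                               ∎
      where open ≡-Reasoning

  unexplored-or-complete : ∀ {k} (X : Exploration E k) → (∃ λ w → ¬ Explored X w) ⊎ (∀ w → Explored X w)
  unexplored-or-complete X with Finₚ.any? (λ w → ¬? (explored? X w))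
  ... | yes unexplored = inj₁ unexplored
  ... | no none = inj₂ λ w → decidable-stable (explored? X w) (λ w∉X → none (w , w∉X))

  module _ (connected : Connected E) where

    grow : ∀ {k} (X : Exploration E k) → (∃ λ w → ¬ Explored X w) → Exploration E (suc k)
    grow X (w , w∉X) with walk-crossing (explored? X) (connected (vertex X 0) w) (0 , s≤s z≤n , refl) w∉X
    ... | _ , _ , u∈X , v∉X , u~v = extend X u∈X v∉X u~v

    explore : ∀ k → k ≤ n → Exploration E k
    explore zero _ = root
    explore (suc k) k<n with X ← explore k (<⇒≤ k<n) | unexplored-or-complete X
    ... | inj₁ unexplored = grow X unexplored
    ... | inj₂ complete = contradiction (complete-bound X complete) (<⇒≱ k<n)

    spanning-exploration : Σ (Exploration E n) λ X → ∀ w → Explored X w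
    spanning-exploration with X ← explore n ≤-refl | unexplored-or-complete X
    ... | inj₁ unexplored = contradiction (exploration-bound (grow X unexplored)) (<-irrefl refl)
    ... | inj₂ complete = X , complete

-- The coloured graph of a spanning exploration

module Construction {m : ℕ} {T : EdgeList (suc (suc m))} (X : Exploration T (suc m))
                    (complete : ∀ w → Exploration.Explored X w) where

  open Exploration X

  n : ℕ
  n = suc m

  pos : Fin (suc n) → ℕ
  pos w = proj₁ (complete w)

  pos≤ : ∀ w → pos w ≤ n
  pos≤ w = m<1+n⇒m≤n (proj₁ (proj₂ (complete w)))

  vertex-pos : ∀ w → vertex (pos w) ≡ w
  vertex-pos w = proj₂ (proj₂ (complete w))

  pos-vertex : ∀ {i} → i ≤ n → pos (vertex i) ≡ i
  pos-vertex i≤n = vertex-injective (pos≤ _) i≤n (vertex-pos _)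

  parent≤n : ∀ {k} → k < n → parent (suc k) ≤ n
  parent≤n k<n = ≤-trans (parent≤ k<n) (<⇒≤ k<n)

  pos-vertex-≤ : ∀ {i k} → i ≤ k → k ≤ n → pos (vertex i) ≤ k
  pos-vertex-≤ {k = k} i≤k k≤n = subst (_≤ k) (sym (pos-vertex (≤-trans i≤k k≤n))) i≤k

  colourNumber : ℕ → ℕ → ℕ
  colourNumber a b with a ≟ parent b
  ... | yes _ = b ∸ 1
  ... | no _ = b

  -- Pairs (a , n) occur in G only as a tree edge, so colour numbers of edges of G stay below n
  -- and `mod n` never wraps.
  colour : Colouring (suc n) n
  colour (x , y) = colourNumber (pos x ⊓ pos y) (pos x ⊔ pos y) mod n

  colour-sym : ∀ x y → colour (x , y) ≡ colour (y , x)
  colour-sym x y = cong₂ (λ a b → colourNumber a b mod n) (⊓-comm (pos x) (pos y)) (⊔-comm (pos x) (pos y))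

  colour-edge : ∀ {a b} → a < b → b ≤ n → colour (edge (vertex a) (vertex b)) ≡ colourNumber a b mod n
  colour-edge {a} {b} a<b b≤n = begin
    colour (edge (vertex a) (vertex b))
      ≡⟨ unoriented (edge-joins (vertex a) (vertex b)) ⟩
    colour (vertex a , vertex b)
      ≡⟨ cong₂ (λ i j → colourNumber (i ⊓ j) (i ⊔ j) mod n) (pos-vertex a≤n) (pos-vertex b≤n) ⟩
    colourNumber (a ⊓ b) (a ⊔ b) mod n
      ≡⟨ cong₂ (λ i j → colourNumber i j mod n) (m≤n⇒m⊓n≡m (<⇒≤ a<b)) (m≤n⇒m⊔n≡n (<⇒≤ a<b)) ⟩
    colourNumber a b mod n
      ∎
    where
    open ≡-Reasoning
    a≤n = <⇒≤ (<-≤-trans a<b b≤n)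
    unoriented : ∀ {f x y} → Joins f x y → colour f ≡ colour (x , y)
    unoriented (inj₁ refl) = refl
    unoriented {x = x} {y} (inj₂ refl) = colour-sym y x

  treePair : ℕ → ℕ × ℕ
  treePair k = parent (suc k) , suc k

  -- Colour class k, as pairs of positions.
  block : ℕ → List (ℕ × ℕ)
  block k = treePair k ∷ map (_, k) (filter (_≢? parent k) (downFrom k))

  pairsBelow : ℕ → List (ℕ × ℕ)
  pairsBelow zero = []
  pairsBelow (suc k) = block k ++ pairsBelow k

  toEdge : ℕ × ℕ → Edge (suc n)
  toEdge (a , b) = edge (vertex a) (vertex b)

  G : EdgeList (suc n)
  G = map toEdge (pairsBelow n)

  treeEdge : ℕ → Edge (suc n)
  treeEdge = toEdge ∘ treePair

  treeEdges : EdgeList (suc n)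
  treeEdges = map treeEdge (downFrom n)

  data InBlock (k : ℕ) : ℕ × ℕ → Set where
    tree : InBlock k (treePair k)
    nonTree : ∀ {a} → a < k → a ≢ parent k → InBlock k (a , k)

  ∈block⇒InBlock : ∀ {k e} → e ∈ block k → InBlock k e
  ∈block⇒InBlock (here refl) = tree
  ∈block⇒InBlock {k} (there e∈) with ∈-map⁻ (_, k) e∈
  ... | a , a∈ , refl with ∈-filter⁻ (_≢? parent k) {xs = downFrom k} a∈
  ...   | a∈downFrom , a≢ = nonTree (∈-downFrom⁻ a∈downFrom) a≢

  ∈pairsBelow⁻ : ∀ {e} k′ → e ∈ pairsBelow k′ → ∃ λ k → k < k′ × e ∈ block k
  ∈pairsBelow⁻ (suc k′) e∈ with ∈-++⁻ (block k′) e∈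
  ... | inj₁ e∈block = k′ , ≤-refl , e∈block
  ... | inj₂ e∈below with ∈pairsBelow⁻ k′ e∈below
  ...   | k , k<k′ , e∈block = k , m<n⇒m<1+n k<k′ , e∈block

  ∈pairsBelow⁺ : ∀ {e k} k′ → k < k′ → e ∈ block k → e ∈ pairsBelow k′
  ∈pairsBelow⁺ (suc k′) k<1+k′ e∈block with m<1+n⇒m<n∨m≡n k<1+k′
  ... | inj₁ k<k′ = ∈-++⁺ʳ (block k′) (∈pairsBelow⁺ k′ k<k′ e∈block)
  ... | inj₂ refl = ∈-++⁺ˡ e∈block

  InBlock-< : ∀ {k a b} → k < n → InBlock k (a , b) → a < b × b ≤ n
  InBlock-< k<n tree = s≤s (parent≤ k<n) , k<n
  InBlock-< k<n (nonTree a<k _) = a<k , <⇒≤ k<n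

  InBlock-colourNumber : ∀ {k a b} → InBlock k (a , b) → colourNumber a b ≡ k
  InBlock-colourNumber {k} tree with parent (suc k) ≟ parent (suc k)
  ... | yes _ = refl
  ... | no p≢p = contradiction refl p≢p
  InBlock-colourNumber {k} (nonTree {a} _ a≢p) with a ≟ parent k
  ... | yes a≡p = contradiction a≡p a≢p
  ... | no _ = refl

  InBlock-colour : ∀ {k a b} → k < n → InBlock k (a , b) → colour (toEdge (a , b)) ≡ k mod n
  InBlock-colour k<n inBlock =
    trans (uncurry colour-edge (InBlock-< k<n inBlock)) (cong (_mod n) (InBlock-colourNumber inBlock))

  colour-∈block : ∀ {k e} → k < n → e ∈ block k → colour (toEdge e) ≡ k mod n
  colour-∈block {e = _ , _} k<n e∈ = InBlock-colour k<n (∈block⇒InBlock e∈)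

  Within : ℕ → Edge (suc n) → Set
  Within k (x , y) = pos x ≤ k × pos y ≤ k

  Within-toEdge : ∀ {a b k} → a ≤ k → b ≤ k → k ≤ n → Within k (toEdge (a , b))
  Within-toEdge {a} {b} {k} a≤k b≤k k≤n with edge-joins (vertex a) (vertex b)
  ... | inj₁ eq = subst (Within k) (sym eq) (pos-vertex-≤ a≤k k≤n , pos-vertex-≤ b≤k k≤n)
  ... | inj₂ eq = subst (Within k) (sym eq) (pos-vertex-≤ b≤k k≤n , pos-vertex-≤ a≤k k≤n)

  Within-joins : ∀ {k f x y} → Within k f → Joins f x y → pos x ≤ k
  Within-joins (x≤k , _) (inj₁ refl) = x≤k
  Within-joins (_ , x≤k) (inj₂ refl) = x≤k

  ∈G⇒tree-or-within : ∀ {f} → f ∈ G → ∃ λ k → k < n × colour f ≡ k mod n × (f ≡ treeEdge k ⊎ Within k f)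
  ∈G⇒tree-or-within f∈G with ∈-map⁻ toEdge f∈G
  ... | _ , e∈ , refl with ∈pairsBelow⁻ n e∈
  ...   | k , k<n , e∈block with ∈block⇒InBlock e∈block
  ...     | tree = k , k<n , InBlock-colour k<n tree , inj₁ refl
  ...     | nonTree a<k a≢p =
    k , k<n , InBlock-colour k<n (nonTree a<k a≢p) , inj₂ (Within-toEdge (<⇒≤ a<k) ≤-refl (<⇒≤ k<n))

  treeEdge-colour : ∀ {k} → k < n → colour (treeEdge k) ≡ k mod n
  treeEdge-colour k<n = InBlock-colour k<n tree

  treeEdge∈G : ∀ {k} → k < n → treeEdge k ∈ G
  treeEdge∈G k<n = ∈-map⁺ toEdge (∈pairsBelow⁺ n k<n (here refl))

  ∈treeEdges⁻ : ∀ {f} → f ∈ treeEdges → ∃ λ k → k < n × f ≡ treeEdge k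
  ∈treeEdges⁻ f∈ with ∈-map⁻ treeEdge f∈
  ... | k , k∈ , refl = k , ∈-downFrom⁻ k∈ , refl

  ∈treeEdges⁺ : ∀ {k} → k < n → treeEdge k ∈ treeEdges
  ∈treeEdges⁺ k<n = ∈-map⁺ treeEdge (∈-downFrom⁺ k<n)

  treeEdges⊆G : treeEdges ⊆E G
  treeEdges⊆G f f∈ with ∈treeEdges⁻ f∈
  ... | k , k<n , refl = treeEdge∈G k<n

  treeEdges-heterochromatic : Heterochromatic colour treeEdges
  treeEdges-heterochromatic f g f∈ g∈ same-colour with ∈treeEdges⁻ f∈ | ∈treeEdges⁻ g∈
  ... | k , k<n , refl | k′ , k′<n , refl =
    cong treeEdge (mod-injective k<n k′<n (trans (sym (treeEdge-colour k<n)) (trans same-colour (treeEdge-colour k′<n))))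

  treeEdges⊆T : WF T → treeEdges ⊆E T
  treeEdges⊆T wfT f f∈ with ∈treeEdges⁻ f∈
  ... | k , k<n , refl = edge-∈ wfT (Adj-sym (parent-adj k<n))

  walk-to-root : ∀ i → i ≤ n → Walk treeEdges (vertex i) (vertex 0)
  walk-to-root = <-rec (λ i → i ≤ n → Walk treeEdges (vertex i) (vertex 0)) go
    where
    go : ∀ i → (∀ {j} → j < i → j ≤ n → Walk treeEdges (vertex j) (vertex 0)) →
         i ≤ n → Walk treeEdges (vertex i) (vertex 0)
    go zero _ _ = here
    go (suc i) rec i<n =
      step (Adj-sym (joining⇒Adj (∈treeEdges⁺ i<n) (edge-joins _ _)))
           (rec (s≤s (parent≤ i<n)) (parent≤n i<n))

  treeEdges-connected : Connected treeEdges
  treeEdges-connected u w = walk-++ (to-root u) (walk-reverse (to-root w))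
    where
    to-root : ∀ u → Walk treeEdges u (vertex 0)
    to-root u = subst (λ x → Walk treeEdges x (vertex 0)) (vertex-pos u) (walk-to-root (pos u) (pos≤ u))

  data Descendant (r : ℕ) : ℕ → Set where
    self : Descendant r r
    child : ∀ {i} → r ≤ i → Descendant r (parent (suc i)) → Descendant r (suc i)

  Descendant-≥ : ∀ {r i} → Descendant r i → r ≤ i
  Descendant-≥ self = ≤-refl
  Descendant-≥ (child r≤i _) = m≤n⇒m≤1+n r≤i

  Descendant-parent : ∀ {r i} → Descendant r (suc i) → r ≤ i → Descendant r (parent (suc i))
  Descendant-parent self 1+i≤i = contradiction 1+i≤i (<-irrefl refl)
  Descendant-parent (child _ d) _ = d

  joins-tree-or-within-≤ : ∀ {k f x y} → k < n → f ≡ treeEdge k ⊎ Within k f → Joins f x y → pos x ≤ suc k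
  joins-tree-or-within-≤ k<n (inj₂ within) f-joins = m≤n⇒m≤1+n (Within-joins within f-joins)
  joins-tree-or-within-≤ k<n (inj₁ refl) f-joins with Joins-edge f-joins
  ... | inj₁ (refl , _) = pos-vertex-≤ (m≤n⇒m≤1+n (parent≤ k<n)) k<n
  ... | inj₂ (refl , _) = pos-vertex-≤ ≤-refl k<n

  module Uniqueness (S : EdgeList (suc n)) (S⊆G : S ⊆E G) (S-connected : Connected S)
                    (S-heterochromatic : Heterochromatic colour S) where

    coloured-like-tree : ∀ {f k} → f ∈ S → k < n → treeEdge k ∈ S → colour f ≡ k mod n → f ≡ treeEdge k
    coloured-like-tree f∈S k<n tree∈S f-colour =
      S-heterochromatic _ _ f∈S tree∈S (trans f-colour (sym (treeEdge-colour k<n)))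

    module _ {k₀} (k₀<n : k₀ < n) (above : ∀ {k} → k₀ < k → k < n → treeEdge k ∈ S) where

      Inside : ℕ → Set
      Inside = Descendant (suc k₀)

      tree-step : ∀ {k x y} → k₀ < k → k < n → Joins (treeEdge k) x y → Inside (pos x) → Inside (pos y)
      tree-step k₀<k k<n joins x-in with Joins-edge joins
      ... | inj₁ (refl , refl) =
        subst Inside (sym (pos-vertex k<n)) (child k₀<k (subst Inside (pos-vertex (parent≤n k<n)) x-in))
      ... | inj₂ (refl , refl) =
        subst Inside (sym (pos-vertex (parent≤n k<n)))
              (Descendant-parent (subst Inside (pos-vertex k<n) x-in) k₀<k)

      -- An edge of S with a colour k > k₀ is the tree edge of colour k, which does not leave the
      -- descendants; any other edge except `treeEdge k₀` has both ends at positions ≤ k₀.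
      step-out : ∀ {x y} → Adj S x y → Inside (pos x) → treeEdge k₀ ∈ S ⊎ Inside (pos y)
      step-out x~y x-in with Adj⇒joining x~y
      ... | f , f∈S , f-joins with ∈G⇒tree-or-within (S⊆G f f∈S)
      ...   | k , k<n , f-colour , shape with <-cmp k₀ k | shape
      ...     | tri< k₀<k _ _ | _ =
        inj₂ (tree-step k₀<k k<n (subst (λ g → Joins g _ _) f≡tree f-joins) x-in)
        where f≡tree = coloured-like-tree f∈S k<n (above k₀<k k<n) f-colour
      ...     | tri≈ _ refl _ | inj₁ refl = inj₁ f∈S
      ...     | tri≈ _ refl _ | inj₂ within = contradiction (Descendant-≥ x-in) (<⇒≱ (s≤s (Within-joins within f-joins)))
      ...     | tri> _ _ k<k₀ | shape =
        contradiction (Descendant-≥ x-in) (<⇒≱ (s≤s (≤-trans (joins-tree-or-within-≤ k<n shape f-joins) k<k₀)))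

      escape : ∀ {x w} → Walk S x w → Inside (pos x) → ¬ Inside (pos w) → treeEdge k₀ ∈ S
      escape here x-in w-out = contradiction x-in w-out
      escape (step x~y w) x-in w-out with step-out x~y x-in
      ... | inj₁ tree∈S = tree∈S
      ... | inj₂ y-in = escape w y-in w-out

      treeEdge∈S : treeEdge k₀ ∈ S
      treeEdge∈S = escape (S-connected (vertex (suc k₀)) (vertex 0)) (subst Inside (sym (pos-vertex k₀<n)) self) root-out
        where
        root-out : ¬ Inside (pos (vertex 0))
        root-out inside = contradiction (subst (suc k₀ ≤_) (pos-vertex z≤n) (Descendant-≥ inside)) λ ()

    treeEdges-from : ∀ d {k} → d + k ≡ n → ∀ {j} → k ≤ j → j < n → treeEdge j ∈ S
    treeEdges-from zero refl n≤j j<n = contradiction n≤j (<⇒≱ j<n)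
    treeEdges-from (suc d) {k} 1+d+k≡n {j} k≤j j<n = from-k (m≤n⇒m<n∨m≡n k≤j)
      where
      from-1+k : ∀ {j} → suc k ≤ j → j < n → treeEdge j ∈ S
      from-1+k = treeEdges-from d (trans (+-suc d k) 1+d+k≡n)
      from-k : k < j ⊎ k ≡ j → treeEdge j ∈ S
      from-k (inj₁ k<j) = from-1+k k<j j<n
      from-k (inj₂ refl) = treeEdge∈S j<n from-1+k

    treeEdges⊆S : treeEdges ⊆E S
    treeEdges⊆S f f∈ with ∈treeEdges⁻ f∈
    ... | k , k<n , refl = treeEdges-from n (+-identityʳ n) z≤n k<n

    S⊆treeEdges : S ⊆E treeEdges
    S⊆treeEdges f f∈S with ∈G⇒tree-or-within (S⊆G f f∈S)
    ... | k , k<n , f-colour , _ =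
      subst (_∈ treeEdges) (sym (coloured-like-tree f∈S k<n (treeEdges⊆S _ (∈treeEdges⁺ k<n)) f-colour)) (∈treeEdges⁺ k<n)

  module _ (j : Fin n) where

    hasColour : (e : ℕ × ℕ) → Dec (colour (toEdge e) ≡ j)
    hasColour e = colour (toEdge e) Fin.≟ j

    filter-block-≡ : filter hasColour (block (toℕ j)) ≡ block (toℕ j)
    filter-block-≡ = filter-all hasColour (All.tabulate λ e∈ →
      trans (colour-∈block (toℕ<n j) e∈) (toℕ-injective (toℕ-mod (toℕ<n j))))

    filter-block-≢ : ∀ {k} → k < n → k ≢ toℕ j → filter hasColour (block k) ≡ []
    filter-block-≢ k<n k≢j = filter-none hasColour (All.tabulate λ e∈ e-colour →
      k≢j (trans (sym (toℕ-mod k<n)) (cong toℕ (trans (sym (colour-∈block k<n e∈)) e-colour))))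

    filter-pairsBelow-≤ : ∀ k → k ≤ toℕ j → filter hasColour (pairsBelow k) ≡ []
    filter-pairsBelow-≤ zero _ = refl
    filter-pairsBelow-≤ (suc k) k<j =
      trans (filter-++ hasColour (block k) (pairsBelow k))
            (cong₂ _++_ (filter-block-≢ (<-trans k<j (toℕ<n j)) (<⇒≢ k<j)) (filter-pairsBelow-≤ k (<⇒≤ k<j)))

    filter-pairsBelow-> : ∀ k → toℕ j < k → k ≤ n → filter hasColour (pairsBelow k) ≡ block (toℕ j)
    filter-pairsBelow-> (suc k) j<1+k k<n with m<1+n⇒m<n∨m≡n j<1+k
    ... | inj₁ j<k =
      trans (filter-++ hasColour (block k) (pairsBelow k))
            (cong₂ _++_ (filter-block-≢ k<n (<⇒≢ j<k ∘ sym)) (filter-pairsBelow-> k j<k (<⇒≤ k<n)))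
    ... | inj₂ refl =
      trans (filter-++ hasColour (block k) (pairsBelow k))
            (trans (cong₂ _++_ filter-block-≡ (filter-pairsBelow-≤ k ≤-refl)) (++-identityʳ (block k)))

    classSize-block : classSize G colour j ≡ length (block (toℕ j))
    classSize-block = begin
      length (filter (λ f → colour f Fin.≟ j) (map toEdge (pairsBelow n)))
        ≡⟨ cong length (filter-map (λ f → colour f Fin.≟ j) toEdge (pairsBelow n)) ⟩
      length (map toEdge (filter hasColour (pairsBelow n)))
        ≡⟨ length-map toEdge (filter hasColour (pairsBelow n)) ⟩
      length (filter hasColour (pairsBelow n))
        ≡⟨ cong length (filter-pairsBelow-> n (toℕ<n j) ≤-refl) ⟩
      length (block (toℕ j))
        ∎
      where open ≡-Reasoning

  length-block-suc : ∀ {i} → suc i < n → length (block (suc i)) ≡ suc i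
  length-block-suc {i} 1+i<n =
    trans (cong suc (length-map (_, suc i) (filter (_≢? parent (suc i)) (downFrom (suc i)))))
          (length-filter-≢-downFrom (s≤s (parent≤ (<⇒≤ 1+i<n))))

  classSizes : map (classSize G colour) (allFin n) ≡ cuteSizes n
  classSizes = begin
    map (classSize G colour) (allFin n)   ≡⟨ map-tabulate (λ i → i) (classSize G colour) ⟩
    tabulate (classSize G colour)         ≡⟨ cong₂ _∷_ (classSize-block Fin.zero) (tabulate-cong size-suc) ⟩
    1 ∷ tabulate (suc ∘ toℕ)              ≡⟨ cong (1 ∷_) (tabulate-toℕ m suc) ⟩
    1 ∷ applyUpTo suc m                   ≡⟨ cong (1 ∷_) (sym (map-upTo suc m)) ⟩
    cuteSizes n                           ∎
    where
    open ≡-Reasoning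
    size-suc : ∀ i → classSize G colour (Fin.suc i) ≡ suc (toℕ i)
    size-suc i = trans (classSize-block (Fin.suc i)) (length-block-suc (s≤s (toℕ<n i)))

  length-pairsBelow : ∀ k → k < n → length (pairsBelow (suc k)) ≡ 1 + suc k C 2
  length-pairsBelow zero _ = refl
  length-pairsBelow (suc k) 1+k<n = begin
    length (block (suc k) ++ pairsBelow (suc k))          ≡⟨ length-++ (block (suc k)) ⟩
    length (block (suc k)) + length (pairsBelow (suc k))  ≡⟨ cong₂ _+_ (length-block-suc 1+k<n) (length-pairsBelow k (<⇒≤ 1+k<n)) ⟩
    suc k + (1 + suc k C 2)                               ≡⟨ +-suc (suc k) (suc k C 2) ⟩
    1 + (suc k + suc k C 2)                               ≡⟨ cong (λ c → 1 + (c + suc k C 2)) (sym (nC1≡n (suc k))) ⟩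
    1 + (suc k C 1 + suc k C 2)                           ≡⟨ cong (1 +_) (nCk+nC[k+1]≡[n+1]C[k+1] (suc k) 1) ⟩
    1 + suc (suc k) C 2                                   ∎
    where open ≡-Reasoning

  length-G : length G ≡ 1 + n C 2
  length-G = trans (length-map toEdge (pairsBelow n)) (length-pairsBelow m ≤-refl)

  pair-bounds : ∀ {a b} → (a , b) ∈ pairsBelow n → a < b × b ≤ n
  pair-bounds e∈ with ∈pairsBelow⁻ n e∈
  ... | k , k<n , e∈block = InBlock-< k<n (∈block⇒InBlock e∈block)

  toEdge-injective : ∀ {e e′} → e ∈ pairsBelow n → e′ ∈ pairsBelow n → toEdge e ≡ toEdge e′ → e ≡ e′
  toEdge-injective {a , b} {a′ , b′} e∈ e′∈ eq with pair-bounds e∈ | pair-bounds e′∈ | edge-injective eq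
  ... | a<b , b≤n | a′<b′ , b′≤n | inj₁ (va≡va′ , vb≡vb′) =
    cong₂ _,_ (vertex-injective (<⇒≤ (<-≤-trans a<b b≤n)) (<⇒≤ (<-≤-trans a′<b′ b′≤n)) va≡va′)
              (vertex-injective b≤n b′≤n vb≡vb′)
  ... | a<b , b≤n | a′<b′ , b′≤n | inj₂ (va≡vb′ , vb≡va′) =
    ⊥-elim (<-asym a<b (subst₂ _<_ (sym (vertex-injective b≤n (<⇒≤ (<-≤-trans a′<b′ b′≤n)) vb≡va′))
                                   (sym (vertex-injective (<⇒≤ (<-≤-trans a<b b≤n)) b′≤n va≡vb′)) a′<b′))

  block-unique : ∀ k → Unique (block k)
  block-unique k = All.tabulate tree≢nonTree ∷ Uniqueₚ.map⁺ (cong proj₁) (Uniqueₚ.filter⁺ _ (Uniqueₚ.downFrom⁺ k))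
    where
    tree≢nonTree : ∀ {e} → e ∈ map (_, k) (filter (_≢? parent k) (downFrom k)) → treePair k ≢ e
    tree≢nonTree e∈ eq with ∈-map⁻ (_, k) e∈
    ... | _ , _ , refl = <-irrefl (sym (cong proj₂ eq)) ≤-refl

  pairsBelow-unique : ∀ k → k ≤ n → Unique (pairsBelow k)
  pairsBelow-unique zero _ = []
  pairsBelow-unique (suc k) k<n = Uniqueₚ.++⁺ (block-unique k) (pairsBelow-unique k (<⇒≤ k<n)) disjoint
    where
    disjoint : ∀ {e} → ¬ (e ∈ block k × e ∈ pairsBelow k)
    disjoint {_ , _} (e∈block , e∈below) with ∈pairsBelow⁻ k e∈below
    ... | k′ , k′<k , e∈block′ =
      <-irrefl (trans (sym (InBlock-colourNumber (∈block⇒InBlock e∈block′)))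
                      (InBlock-colourNumber (∈block⇒InBlock e∈block)))
               k′<k

  G-WF : WF G
  G-WF = All.tabulate canonical , Unique-map⁺-∈ toEdge-injective (pairsBelow-unique n ≤-refl)
    where
    canonical : ∀ {f} → f ∈ G → proj₁ f Fin.< proj₂ f
    canonical f∈G with ∈-map⁻ toEdge f∈G
    ... | _ , e∈ , refl with pair-bounds e∈
    ...   | a<b , b≤n = edge-< λ va≡vb → <-irrefl (vertex-injective (<⇒≤ (<-≤-trans a<b b≤n)) b≤n va≡vb) a<b

mainTheorem3 : (n : ℕ) → 1 ≤ n → (T : EdgeList (suc n)) → IsTree T →
    Σ (EdgeList (suc n)) λ G → WF G × T ⊆E G × length G ≡ 1 + n C 2 ×
      Σ (Colouring (suc n) n) λ c → Cute G c × HetSpanningTree G c T ×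
        ((S : EdgeList (suc n)) → HetSpanningTree G c S → SameEdges S T)
mainTheorem3 (suc m) _ T T-tree@(wfT , T-connected , T-acyclic) =
  G , G-WF , T⊆G , length-G , colour , ↭-reflexive classSizes , (T⊆G , T-tree , T-heterochromatic) , unique
  where
  open Construction (proj₁ (spanning-exploration T-connected)) (proj₂ (spanning-exploration T-connected))

  T⊆treeEdges : T ⊆E treeEdges
  T⊆treeEdges = acyclic⇒connected-subgraph-⊇ wfT T-acyclic (treeEdges⊆T wfT) treeEdges-connected

  T⊆G : T ⊆E G
  T⊆G f f∈T = treeEdges⊆G f (T⊆treeEdges f f∈T)

  T-heterochromatic : Heterochromatic colour T
  T-heterochromatic f g f∈T g∈T = treeEdges-heterochromatic f g (T⊆treeEdges f f∈T) (T⊆treeEdges g g∈T)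

  unique : (S : EdgeList (suc (suc m))) → HetSpanningTree G colour S → SameEdges S T
  unique S (S⊆G , (_ , S-connected , _) , S-heterochromatic) =
    (λ f f∈S → treeEdges⊆T wfT f (S⊆treeEdges f f∈S)) , (λ f f∈T → treeEdges⊆S f (T⊆treeEdges f f∈T))
    where open Uniqueness S S⊆G S-connected S-heterochromatic
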